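{- Let $n\geq 1$, let $\tau$ be a triangular norm without zero divisors, and let $\mathbb{X}_1=\langle X_1;\mu_{X_1}\rangle,\dots,\mathbb{X}_n=\langle X_n;\mu_{X_n}\rangle$ be fuzzy posets. Then $\langle \prod_{i=1}^n X_i;\mu_p\rangle$ is a fuzzy poset, where $\mu_p((x_1,\dots,x_n),(y_1,\dots,y_n))=\tau^{(n)}(\mu_{X_1}(x_1,y_1),\dots,\mu_{X_n}(x_n,y_n))$.
   Context: A fuzzy relation on a set $X$ is a map $\mu\colon X\times X\to[0,1]$; it is reflexive if $\mu(x,x)=1$; transitive if $\mu(x,y)>0$ and $\mu(y,z)>0$ imply $\mu(x,z)>0$; anti-symmetric if $\mu(x,y)>0$ and $\mu(y,x)>0$ imply $x=y$. A fuzzy poset is $\langle X;\mu\rangle$ with $\mu$ reflexive, transitive and anti-symmetric. A triangular norm is a map $\tau\colon[0,1]^2\to[0,1]$ that is associative, commutative, monotone in each argument ($b\le c\Rightarrow\tau(a,b)\le\tau(a,c)$) and satisfies $\tau(a,1)=a$. It has zero divisors if there exist $a,b\in(0,1)$ with $\tau(a,b)=0$; otherwise it is without zero divisors. Its $n$-ary extension is $\tau^{(1)}(a_1)=a_1$ and $\tau^{(n)}(a_1,\dots,a_n)=\tau(\tau^{(n-1)}(a_1,\dots,a_{n-1}),a_n)$. -}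

module Defs where

open import Data.Nat using (ℕ; zero; suc)
open import Data.Fin using (Fin; zero; suc; inject₁; fromℕ)
open import Data.Product using (Σ; ∃; ∃₂; _×_; _,_; proj₁; proj₂)
open import Data.Sum using (_⊎_)
open import Function using (_∘_)
open import Relation.Binary.PropositionalEquality using (_≡_)
open import Relation.Nullary using (¬_)
open import Relation.Binary.Definitions using (Trichotomous)

-- An axiomatisation of the real numbers: a Dedekind-complete ordered field
-- (with propositional equality).  Any two such structures are isomorphic,
-- so quantifying over all of them is the same as working with ℝ.
record RealField : Set₁ where
  infixl 6 _+_
  infixl 7 _*_
  infix 4 _<_
  field
    ℝ : Set
    0ℝ 1ℝ : ℝ
    _+_ _*_ : ℝ → ℝ → ℝ
    -_ : ℝ → ℝ
    _<_ : ℝ → ℝ → Set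
    +-assoc : ∀ x y z → (x + y) + z ≡ x + (y + z)
    +-comm : ∀ x y → x + y ≡ y + x
    +-identityˡ : ∀ x → 0ℝ + x ≡ x
    -‿inverseˡ : ∀ x → (- x) + x ≡ 0ℝ
    *-assoc : ∀ x y z → (x * y) * z ≡ x * (y * z)
    *-comm : ∀ x y → x * y ≡ y * x
    *-identityˡ : ∀ x → 1ℝ * x ≡ x
    distribˡ : ∀ x y z → x * (y + z) ≡ x * y + x * z
    0≢1 : ¬ 0ℝ ≡ 1ℝ
    *-inverse : ∀ x → ¬ x ≡ 0ℝ → ∃ λ y → x * y ≡ 1ℝ
    <-trans : ∀ {x y z} → x < y → y < z → x < z
    <-tri : Trichotomous _≡_ _<_
    +-mono-< : ∀ {x y} z → x < y → x + z < y + z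
    *-pos : ∀ {x y} → 0ℝ < x → 0ℝ < y → 0ℝ < x * y
    -- least-upper-bound property (x ≤ y written as x < y ⊎ x ≡ y)
    complete : (P : ℝ → Set) → ∃ P →
               (∃ λ b → ∀ x → P x → x < b ⊎ x ≡ b) →
               ∃ λ s → (∀ x → P x → x < s ⊎ x ≡ s) ×
                       (∀ b → (∀ x → P x → x < b ⊎ x ≡ b) → s < b ⊎ s ≡ b)

module _ (R : RealField) where
  open RealField R

  infix 4 _≤_
  _≤_ : ℝ → ℝ → Set
  x ≤ y = x < y ⊎ x ≡ y

  InI : ℝ → Set
  InI r = 0ℝ ≤ r × r ≤ 1ℝ

  IsFuzzyRelation : {X : Set} → (X → X → ℝ) → Set
  IsFuzzyRelation {X} μ = ∀ (x y : X) → InI (μ x y)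

  FReflexive : {X : Set} → (X → X → ℝ) → Set
  FReflexive {X} μ = ∀ (x : X) → μ x x ≡ 1ℝ

  FTransitive : {X : Set} → (X → X → ℝ) → Set
  FTransitive {X} μ = ∀ (x y z : X) → 0ℝ < μ x y → 0ℝ < μ y z → 0ℝ < μ x z

  FAntiSymmetric : {X : Set} → (X → X → ℝ) → Set
  FAntiSymmetric {X} μ = ∀ (x y : X) → 0ℝ < μ x y → 0ℝ < μ y x → x ≡ y

  IsFuzzyPoset : {X : Set} → (X → X → ℝ) → Set
  IsFuzzyPoset μ = IsFuzzyRelation μ × FReflexive μ × FTransitive μ × FAntiSymmetric μ

  -- triangular norm: a map [0,1]² → [0,1] (represented as ℝ → ℝ → ℝ, only
  -- its values on [0,1] matter)
  record IsTNorm (τ : ℝ → ℝ → ℝ) : Set where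
    field
      closed : ∀ a b → InI a → InI b → InI (τ a b)
      assoc : ∀ a b c → InI a → InI b → InI c → τ (τ a b) c ≡ τ a (τ b c)
      comm : ∀ a b → InI a → InI b → τ a b ≡ τ b a
      mono : ∀ a b c → InI a → InI b → InI c → b ≤ c → τ a b ≤ τ a c
      identity : ∀ a → InI a → τ a 1ℝ ≡ a

  HasZeroDivisors : (ℝ → ℝ → ℝ) → Set
  HasZeroDivisors τ = ∃₂ λ a b → (0ℝ < a × a < 1ℝ) × (0ℝ < b × b < 1ℝ) × τ a b ≡ 0ℝ

  WithoutZeroDivisors : (ℝ → ℝ → ℝ) → Set
  WithoutZeroDivisors τ = ¬ HasZeroDivisors τ

  -- n-ary extension, indexed so that τⁿ n takes (suc n) arguments:
  -- τ⁽¹⁾(a₁) = a₁, τ⁽ⁿ⁺¹⁾(a₁..aₙ₊₁) = τ(τ⁽ⁿ⁾(a₁..aₙ), aₙ₊₁)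
  τⁿ : (ℝ → ℝ → ℝ) → (n : ℕ) → (Fin (suc n) → ℝ) → ℝ
  τⁿ τ zero a = a zero
  τⁿ τ (suc n) a = τ (τⁿ τ n (a ∘ inject₁)) (a (fromℕ (suc n)))

Prod : (n : ℕ) → (Fin (suc n) → Set) → Set
Prod zero X = X zero
Prod (suc n) X = X zero × Prod n (X ∘ suc)

component : (n : ℕ) (X : Fin (suc n) → Set) → Prod n X → (i : Fin (suc n)) → X i
component zero X x zero = x
component (suc n) X (a , _) zero = a
component (suc n) X (_ , r) (suc i) = component n (X ∘ suc) r i

μp : (R : RealField) → (RealField.ℝ R → RealField.ℝ R → RealField.ℝ R) →
     (n : ℕ) (X : Fin (suc n) → Set) →
     ((i : Fin (suc n)) → X i → X i → RealField.ℝ R) →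
     Prod n X → Prod n X → RealField.ℝ R
μp R τ n X μ x y = τⁿ R τ n (λ i → μ i (component n X x i) (component n X y i))

-- A t-norm is 1 at (1,1) and, when it has no zero divisors, is positive exactly
-- when both arguments are (a zero argument forces the value 0 by monotonicity and
-- τ(0,1) = 0).  Hence τ⁽ⁿ⁾ is 1 on (1,…,1), and μp(x,y) > 0 holds exactly when
-- μᵢ(xᵢ,yᵢ) > 0 for every i.  Reflexivity, transitivity and antisymmetry of the
-- product then follow componentwise, since all three only concern these supports.
module Submission where

open import Defs hiding (_≤_; InI)
import Defs
open import Data.Nat using (ℕ; zero; suc)
open import Data.Fin using (Fin; zero; suc; inject₁; fromℕ)
open import Data.Product using (_,_; proj₁; proj₂)
open import Data.Sum using (inj₁; inj₂)
open import Data.Empty using (⊥-elim)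
open import Function using (_∘_)
open import Relation.Binary.PropositionalEquality using (_≡_; refl; sym; trans; cong₂; subst)
open import Relation.Binary.Definitions using (tri<; tri≈; tri>)
open import Relation.Nullary using (¬_)

∀-snoc : ∀ {ℓ} n {P : Fin (suc n) → Set ℓ} →
         (∀ j → P (inject₁ j)) → P (fromℕ n) → ∀ i → P i
∀-snoc zero    init last zero    = last
∀-snoc (suc n) init last zero    = init zero
∀-snoc (suc n) init last (suc i) = ∀-snoc n (init ∘ suc) last i

component-injective : (n : ℕ) (X : Fin (suc n) → Set) (x y : Prod n X) →
  (∀ i → component n X x i ≡ component n X y i) → x ≡ y
component-injective zero    X x       y       eq = eq zero
component-injective (suc n) X (a , x) (b , y) eq =
  cong₂ _,_ (eq zero) (component-injective n (X ∘ suc) x y (eq ∘ suc))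

module OrderedField (R : RealField) where
  open RealField R public

  infix 4 _≤_
  _≤_ : ℝ → ℝ → Set
  _≤_ = Defs._≤_ R

  InI : ℝ → Set
  InI = Defs.InI R

  <-irrefl : ∀ {x} → ¬ x < x
  <-irrefl {x} x<x with <-tri x x
  ... | tri< _ x≢x _ = x≢x refl
  ... | tri≈ x≮x _ _ = x≮x x<x
  ... | tri> _ x≢x _ = x≢x refl

  ≤-trans : ∀ {x y z} → x ≤ y → y ≤ z → x ≤ z
  ≤-trans (inj₁ x<y)  (inj₁ y<z)  = inj₁ (<-trans x<y y<z)
  ≤-trans (inj₁ x<y)  (inj₂ refl) = inj₁ x<y
  ≤-trans (inj₂ refl) y≤z         = y≤z

  ≤-antisym : ∀ {x y} → x ≤ y → y ≤ x → x ≡ y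
  ≤-antisym (inj₂ x≡y) _          = x≡y
  ≤-antisym (inj₁ _)   (inj₂ y≡x) = sym y≡x
  ≤-antisym (inj₁ x<y) (inj₁ y<x) = ⊥-elim (<-irrefl (<-trans x<y y<x))

  -- 0 ≤ 1 holds in every ordered field; reading it off an element of [0,1]
  -- spares the field-theoretic derivation, and such an element is always at hand.
  0∈I : ∀ {a} → InI a → InI 0ℝ
  0∈I (0≤a , a≤1) = inj₂ refl , ≤-trans 0≤a a≤1

  1∈I : ∀ {a} → InI a → InI 1ℝ
  1∈I (0≤a , a≤1) = ≤-trans 0≤a a≤1 , inj₂ refl

module TNorm (R : RealField) {τ : RealField.ℝ R → RealField.ℝ R → RealField.ℝ R}
             (T : IsTNorm R τ) where
  open OrderedField R
  open IsTNorm T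

  τ-identityˡ : ∀ {b} → InI b → τ 1ℝ b ≡ b
  τ-identityˡ Ib = trans (comm 1ℝ _ (1∈I Ib) Ib) (identity _ Ib)

  τ-zeroˡ : ∀ {b} → InI b → τ 0ℝ b ≡ 0ℝ
  τ-zeroˡ Ib = ≤-antisym τ0b≤0 (proj₁ (closed 0ℝ _ (0∈I Ib) Ib))
    where
      τ0b≤0 : τ 0ℝ _ ≤ 0ℝ
      τ0b≤0 = subst (τ 0ℝ _ ≤_) (identity 0ℝ (0∈I Ib))
                    (mono 0ℝ _ 1ℝ (0∈I Ib) Ib (1∈I Ib) (proj₂ Ib))

  τ-positive⁻¹ˡ : ∀ {a b} → InI a → InI b → 0ℝ < τ a b → 0ℝ < a
  τ-positive⁻¹ˡ (inj₁ 0<a , _)  Ib 0<τ = 0<a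
  τ-positive⁻¹ˡ (inj₂ refl , _) Ib 0<τ = ⊥-elim (<-irrefl (subst (0ℝ <_) (τ-zeroˡ Ib) 0<τ))

  τ-positive⁻¹ʳ : ∀ {a b} → InI a → InI b → 0ℝ < τ a b → 0ℝ < b
  τ-positive⁻¹ʳ Ia Ib 0<τ = τ-positive⁻¹ˡ Ib Ia (subst (0ℝ <_) (comm _ _ Ia Ib) 0<τ)

  τ-positive : WithoutZeroDivisors R τ → ∀ {a b} → InI a → InI b →
               0ℝ < a → 0ℝ < b → 0ℝ < τ a b
  τ-positive nz {a} {b} Ia Ib 0<a 0<b with proj₂ Ia | proj₂ Ib
  ... | inj₂ refl | _         = subst (0ℝ <_) (sym (τ-identityˡ Ib)) 0<b
  ... | inj₁ _    | inj₂ refl = subst (0ℝ <_) (sym (identity a Ia)) 0<a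
  ... | inj₁ a<1  | inj₁ b<1  with proj₁ (closed a b Ia Ib)
  ...   | inj₁ 0<τ = 0<τ
  ...   | inj₂ 0≡τ = ⊥-elim (nz (a , b , (0<a , a<1) , (0<b , b<1) , sym 0≡τ))

  τⁿ-closed : ∀ n (a : Fin (suc n) → ℝ) → (∀ i → InI (a i)) → InI (τⁿ R τ n a)
  τⁿ-closed zero    a Ia = Ia zero
  τⁿ-closed (suc n) a Ia = closed _ _ (τⁿ-closed n (a ∘ inject₁) (Ia ∘ inject₁)) (Ia _)

  τⁿ-ones : ∀ n (a : Fin (suc n) → ℝ) → (∀ i → InI (a i)) →
            (∀ i → a i ≡ 1ℝ) → τⁿ R τ n a ≡ 1ℝ
  τⁿ-ones zero    a Ia a≡1 = a≡1 zero
  τⁿ-ones (suc n) a Ia a≡1 =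
    trans (cong₂ τ (τⁿ-ones n (a ∘ inject₁) (Ia ∘ inject₁) (a≡1 ∘ inject₁)) (a≡1 _))
          (identity 1ℝ (1∈I (Ia zero)))

  τⁿ-positive : WithoutZeroDivisors R τ → ∀ n (a : Fin (suc n) → ℝ) →
                (∀ i → InI (a i)) → (∀ i → 0ℝ < a i) → 0ℝ < τⁿ R τ n a
  τⁿ-positive nz zero    a Ia 0<a = 0<a zero
  τⁿ-positive nz (suc n) a Ia 0<a =
    τ-positive nz (τⁿ-closed n (a ∘ inject₁) (Ia ∘ inject₁)) (Ia _)
      (τⁿ-positive nz n (a ∘ inject₁) (Ia ∘ inject₁) (0<a ∘ inject₁)) (0<a _)

  τⁿ-positive⁻¹ : ∀ n (a : Fin (suc n) → ℝ) → (∀ i → InI (a i)) →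
                  0ℝ < τⁿ R τ n a → ∀ i → 0ℝ < a i
  τⁿ-positive⁻¹ zero    a Ia 0<τ zero = 0<τ
  τⁿ-positive⁻¹ (suc n) a Ia 0<τ =
    ∀-snoc (suc n)
      (τⁿ-positive⁻¹ n (a ∘ inject₁) (Ia ∘ inject₁) (τ-positive⁻¹ˡ init∈I (Ia _) 0<τ))
      (τ-positive⁻¹ʳ init∈I (Ia _) 0<τ)
    where
      init∈I : InI (τⁿ R τ n (a ∘ inject₁))
      init∈I = τⁿ-closed n (a ∘ inject₁) (Ia ∘ inject₁)

lemma4p2 : (R : RealField) (τ : RealField.ℝ R → RealField.ℝ R → RealField.ℝ R) →
    IsTNorm R τ → WithoutZeroDivisors R τ →
    (n : ℕ) (X : Fin (suc n) → Set) (μ : (i : Fin (suc n)) → X i → X i → RealField.ℝ R) →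
    ((i : Fin (suc n)) → IsFuzzyPoset R (μ i)) →
    IsFuzzyPoset R (μp R τ n X μ)
lemma4p2 R τ T nz n X μ poset = isFuzzyRelation , reflexive , transitive , antisymmetric
  where
    open OrderedField R
    open TNorm R T

    c : Prod n X → (i : Fin (suc n)) → X i
    c = component n X

    μᵢ : Prod n X → Prod n X → Fin (suc n) → ℝ
    μᵢ x y i = μ i (c x i) (c y i)

    μᵢ∈I : ∀ x y i → InI (μᵢ x y i)
    μᵢ∈I x y i = proj₁ (poset i) (c x i) (c y i)

    μp-positive⁻¹ : ∀ x y → 0ℝ < μp R τ n X μ x y → ∀ i → 0ℝ < μᵢ x y i
    μp-positive⁻¹ x y = τⁿ-positive⁻¹ n (μᵢ x y) (μᵢ∈I x y)

    isFuzzyRelation : IsFuzzyRelation R (μp R τ n X μ)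
    isFuzzyRelation x y = τⁿ-closed n (μᵢ x y) (μᵢ∈I x y)

    reflexive : FReflexive R (μp R τ n X μ)
    reflexive x = τⁿ-ones n (μᵢ x x) (μᵢ∈I x x) (λ i → proj₁ (proj₂ (poset i)) (c x i))

    transitive : FTransitive R (μp R τ n X μ)
    transitive x y z 0<xy 0<yz = τⁿ-positive nz n (μᵢ x z) (μᵢ∈I x z) λ i →
      proj₁ (proj₂ (proj₂ (poset i))) (c x i) (c y i) (c z i)
        (μp-positive⁻¹ x y 0<xy i) (μp-positive⁻¹ y z 0<yz i)

    antisymmetric : FAntiSymmetric R (μp R τ n X μ)
    antisymmetric x y 0<xy 0<yx = component-injective n X x y λ i →
      proj₂ (proj₂ (proj₂ (poset i))) (c x i) (c y i)
        (μp-positive⁻¹ x y 0<xy i) (μp-positive⁻¹ y x 0<yx i)
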